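{- Let $\langle\mathbf{A}_{\mathrm d},\mathbf{A},\iota\rangle$ be a distributively generated (generalized) additive quantale with multiplication and let $\mathbf{Q}$ be an $\mathbf{A}$-module with a dividing element $u\in Q$. Then: (i) the map $\gamma_u\colon A\to A$, $a\mapsto(a\ast u)/_\ast u$, is a structural nucleus on $\mathbf{A}$ (regarded as an $\mathbf{A}$-module via multiplication); (ii) the submodule $\mathbf{A}\ast u=\{a\ast u: a\in A\}$ of $\mathbf{Q}$ is isomorphic to $\mathbf{A}_{\gamma_u}$ via the mutually inverse maps $x\mapsto x/_\ast u$ and $a\mapsto a\ast u$. In particular, each $u$-cyclic $\mathbf{A}$-module $\mathbf{Q}$ is isomorphic to $\mathbf{A}_{\gamma_u}$.
   Context: Fix one of two parallel settings: plain ("joins" = joins of arbitrary families) or generalized ("joins" = joins of non-empty families). A (generalized) quantale is $\langle Q,\bigvee,+,\mathsf{0}\rangle$ with $Q$ a poset having all such joins, $\langle Q,+,\mathsf{0}\rangle$ a monoid with $+$ order-preserving and distributing over such joins on both sides. A (generalized) additive quantale with multiplication is a triple $\langle\mathbf{A}_{\mathrm d},\mathbf{A},\iota\rangle$: $\mathbf{A}_{\mathrm d}$ a monoid, $\mathbf{A}$ a (generalized) quantale with an additional monoid structure $\langle A,\cdot,\mathsf 1\rangle$, $\iota$ a monoid homomorphism, such that $(\bigvee_i a_i)\cdot b=\bigvee_i(a_i\cdot b)$, $(a+b)\cdot c=a\cdot c+b\cdot c$, $\mathsf0\cdot a=\mathsf0$, and for $d\in\mathbf{A}_{\mathrm d}$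 left multiplication by $\iota(d)$ preserves joins, $+$, $\mathsf0$; distributively generated means $\mathbf{A}$ is generated as a (generalized) quantale by $\iota[\mathbf{A}_{\mathrm d}]$. An $\mathbf{A}$-module is a (generalized) quantale $\mathbf{Q}$ with $\ast\colon A\times Q\to Q$, order-preserving in both coordinates, with $(a\cdot b)\ast x=a\ast(b\ast x)$, $\mathsf1\ast x=x$, $(a+b)\ast x=a\ast x+b\ast x$, $\mathsf0\ast x=\mathsf0$, $(\bigvee_i a_i)\ast x=\bigvee_i(a_i\ast x)$, and $x\mapsto\iota(d)\ast x$ preserving $+$, $\mathsf0$, joins for $d\in\mathbf{A}_{\mathrm d}$; module isomorphisms are bijective quantale homomorphisms commuting with the action. $u$ is a dividing element if for each $y\in Q$ there is $a$ with $a\ast u\leq y$; then $y/_\ast u:=\bigvee\{b\in A:b\ast u\leq y\}$. $\mathbf{Q}$ is $u$-cyclic if $Q=\{a\ast u:a\in A\}$. A structural nucleus on a module is an order-preserving, expansive, idempotent $\gamma$ with $\gamma(x)+\gamma(y)\le\gamma(x+y)$ and $a\ast\gamma(x)\le\gamma(a\ast x)$. For a structural nucleus $\gamma$ on $\mathbf{A}$, $\mathbf{A}_\gamma$ is the module on $\gamma[A]$ with $\bigvee_\gamma X=\gamma(\bigvee X)$, $x+_\gamma y=\gamma(x+y)$, $\mathsf0_\gamma=\gamma(\mathsf0)$, $a\ast_\gamma x=\gamma(a\cdot x)$. -}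

module Defs where

open import Data.Unit using (⊤; tt)
open import Data.Product using (Σ; _×_; _,_; proj₁; proj₂)
open import Relation.Binary.PropositionalEquality
  using (_≡_; refl; sym; trans; cong; subst)
open import Algebra.Structures using (IsMonoid)

-- The two parallel settings.
--   plain       : joins of arbitrary families
--   generalized : joins of non-empty families (non-emptiness witnessed
--                 by an element of the index type)

data Setting : Set where
  plain generalized : Setting

Adm : Setting → Set → Set
Adm plain       I = ⊤
Adm generalized I = I

adm : (s : Setting) {I : Set} → I → Adm s I
adm plain       i = tt
adm generalized i = i

record Quantale (s : Setting) : Set₁ where
  infixl 6 _+_
  infix 4 _≤_
  field
    Carrier    : Set
    _≤_        : Carrier → Carrier → Set
    ≤-refl     : ∀ {x} → x ≤ x
    ≤-trans    : ∀ {x y z} → x ≤ y → y ≤ z → x ≤ z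
    ≤-antisym  : ∀ {x y} → x ≤ y → y ≤ x → x ≡ y
    ⋁          : (I : Set) → Adm s I → (I → Carrier) → Carrier
    ⋁-upper    : ∀ I p (f : I → Carrier) i → f i ≤ ⋁ I p f
    ⋁-least    : ∀ I p (f : I → Carrier) x → (∀ i → f i ≤ x) → ⋁ I p f ≤ x
    _+_        : Carrier → Carrier → Carrier
    0#         : Carrier
    +-isMonoid : IsMonoid _≡_ _+_ 0#
    +-mono     : ∀ {x x′ y y′} → x ≤ x′ → y ≤ y′ → x + y ≤ x′ + y′
    +-distribˡ-⋁ : ∀ x I p (f : I → Carrier) → x + ⋁ I p f ≡ ⋁ I p (λ i → x + f i)
    +-distribʳ-⋁ : ∀ I p (f : I → Carrier) x → ⋁ I p f + x ≡ ⋁ I p (λ i → f i + x)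

record AQM (s : Setting) : Set₁ where
  infixl 7 _·_ _∙_
  field
    D          : Set
    _∙_        : D → D → D
    ε          : D
    ∙-isMonoid : IsMonoid _≡_ _∙_ ε
    quantale   : Quantale s
  open Quantale quantale renaming (Carrier to A)
  field
    _·_        : A → A → A
    1#         : A
    ·-isMonoid : IsMonoid _≡_ _·_ 1#
    ι          : D → A
    ι-∙        : ∀ d e → ι (d ∙ e) ≡ ι d · ι e
    ι-ε        : ι ε ≡ 1#
    ⋁-·        : ∀ I p (f : I → A) b → ⋁ I p f · b ≡ ⋁ I p (λ i → f i · b)
    +-·        : ∀ a b c → (a + b) · c ≡ a · c + b · c
    0-·        : ∀ a → 0# · a ≡ 0#
    ι-·-⋁      : ∀ d I p (f : I → A) → ι d · ⋁ I p f ≡ ⋁ I p (λ i → ι d · f i)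
    ι-·-+      : ∀ d a b → ι d · (a + b) ≡ ι d · a + ι d · b
    ι-·-0      : ∀ d → ι d · 0# ≡ 0#

module _ {s : Setting} (𝔸 : AQM s) where
  open AQM 𝔸
  open Quantale quantale renaming (Carrier to A)

  data Generated : A → Set₁ where
    gen-ι : ∀ d → Generated (ι d)
    gen-⋁ : ∀ I p (f : I → A) → (∀ i → Generated (f i)) → Generated (⋁ I p f)
    gen-+ : ∀ {a b} → Generated a → Generated b → Generated (a + b)
    gen-0 : Generated 0#

  DistributivelyGenerated : Set₁
  DistributivelyGenerated = ∀ a → Generated a

record Module {s : Setting} (𝔸 : AQM s) : Set₁ where
  open AQM 𝔸 using (D; ι; _·_; 1#) renaming (quantale to quantaleA)
  open Quantale quantaleA using () renaming
    (Carrier to A; _≤_ to _≤A_; ⋁ to ⋁A; _+_ to _+A_; 0# to 0A)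
  infixr 7 _*_
  field
    quantale : Quantale s
  open Quantale quantale renaming (Carrier to Q)
  field
    _*_       : A → Q → Q
    *-mono    : ∀ {a a′ x x′} → a ≤A a′ → x ≤ x′ → a * x ≤ a′ * x′
    ·-*       : ∀ a b x → (a · b) * x ≡ a * (b * x)
    1-*       : ∀ x → 1# * x ≡ x
    +-*       : ∀ a b x → (a +A b) * x ≡ a * x + b * x
    0-*       : ∀ x → 0A * x ≡ 0#
    ⋁-*       : ∀ I p (f : I → A) x → ⋁A I p f * x ≡ ⋁ I p (λ i → f i * x)
    ι-*-+     : ∀ d x y → ι d * (x + y) ≡ ι d * x + ι d * y
    ι-*-0     : ∀ d → ι d * 0# ≡ 0#
    ι-*-⋁     : ∀ d I p (f : I → Q) → ι d * ⋁ I p f ≡ ⋁ I p (λ i → ι d * f i)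

-- Structural nuclei, stated for a (generalized) quantale Q together with
-- an action _*_ : A → Q → Q (for A regarded as an A-module the action is
-- multiplication _·_).

record IsStructuralNucleus {s : Setting} {A : Set} (Q : Quantale s)
         (_*_ : A → Quantale.Carrier Q → Quantale.Carrier Q)
         (γ : Quantale.Carrier Q → Quantale.Carrier Q) : Set where
  open Quantale Q
  field
    mono       : ∀ {x y} → x ≤ y → γ x ≤ γ y
    expansive  : ∀ x → x ≤ γ x
    idempotent : ∀ x → γ (γ x) ≡ γ x
    +-lax      : ∀ x y → γ x + γ y ≤ γ (x + y)
    *-lax      : ∀ a x → a * γ x ≤ γ (a * x)

module _ {s : Setting} {𝔸 : AQM s} (M : Module 𝔸) where
  open AQM 𝔸 using (_·_) renaming (quantale to quantaleA)
  open Quantale quantaleA using () renaming (Carrier to A; ⋁ to ⋁A)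
  open Module M
  open Quantale quantale renaming (Carrier to Q)

  IsDividing : Q → Set
  IsDividing u = ∀ y → Σ A (λ a → a * u ≤ y)

  divide : (u : Q) → IsDividing u → Q → A
  divide u div y =
    ⋁A (Σ A (λ b → b * u ≤ y)) (adm s (div y)) proj₁

  γ : (u : Q) → IsDividing u → A → A
  γ u div a = divide u div (a * u)

  IsCyclic : Q → Set
  IsCyclic u = ∀ x → Σ A (λ a → x ≡ a * u)

record ModSig (s : Setting) (A : Set) : Set₁ where
  field
    Carrier : Set
    _≈_     : Carrier → Carrier → Set
    ⋁       : (I : Set) → Adm s I → (I → Carrier) → Carrier
    _+_     : Carrier → Carrier → Carrier
    0#      : Carrier
    _*_     : A → Carrier → Carrier

record IsModuleIso {s : Setting} {A : Set} (M N : ModSig s A)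
         (φ : ModSig.Carrier M → ModSig.Carrier N)
         (ψ : ModSig.Carrier N → ModSig.Carrier M) : Set₁ where
  private
    module M = ModSig M
    module N = ModSig N
  field
    φ-cong : ∀ {x y} → x M.≈ y → φ x N.≈ φ y
    ψ-cong : ∀ {x y} → x N.≈ y → ψ x M.≈ ψ y
    ψ∘φ    : ∀ x → ψ (φ x) M.≈ x
    φ∘ψ    : ∀ y → φ (ψ y) N.≈ y
    φ-⋁    : ∀ I p (f : I → M.Carrier) → φ (M.⋁ I p f) N.≈ N.⋁ I p (λ i → φ (f i))
    φ-+    : ∀ x y → φ (x M.+ y) N.≈ (φ x N.+ φ y)
    φ-0    : φ M.0# N.≈ N.0#
    φ-*    : ∀ a x → φ (a M.* x) N.≈ (a N.* φ x)

module _ {s : Setting} {𝔸 : AQM s} (M : Module 𝔸) where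
  open AQM 𝔸 using (_·_) renaming (quantale to quantaleA)
  open Quantale quantaleA using () renaming (Carrier to A; ⋁ to ⋁A; _+_ to _+A_; 0# to 0A)
  open Module M
  open Quantale quantale renaming (Carrier to Q)

  moduleSig : ModSig s A
  moduleSig = record
    { Carrier = Q ; _≈_ = _≡_ ; ⋁ = ⋁ ; _+_ = _+_ ; 0# = 0# ; _*_ = _*_ }

  Cyc : Q → Set
  Cyc u = Σ Q (λ x → Σ A (λ a → x ≡ a * u))

  private
    ⋁-cyc : (u : Q) (I : Set) (p : Adm s I) (f : I → Cyc u) →
            ⋁ I p (λ i → proj₁ (f i)) ≡ ⋁A I p (λ i → proj₁ (proj₂ (f i))) * u
    ⋁-cyc u I p f = trans
      (≤-antisym
        (⋁-least I p _ _ (λ i →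
           subst (λ z → z ≤ ⋁ I p (λ j → proj₁ (proj₂ (f j)) * u))
                 (sym (proj₂ (proj₂ (f i))))
                 (⋁-upper I p (λ j → proj₁ (proj₂ (f j)) * u) i)))
        (⋁-least I p _ _ (λ i →
           subst (λ z → z ≤ ⋁ I p (λ j → proj₁ (f j)))
                 (proj₂ (proj₂ (f i)))
                 (⋁-upper I p (λ j → proj₁ (f j)) i))))
      (sym (⋁-* I p (λ i → proj₁ (proj₂ (f i))) u))

  cyclicSubmodule : (u : Q) → ModSig s A
  cyclicSubmodule u = record
    { Carrier = Cyc u
    ; _≈_ = λ x y → proj₁ x ≡ proj₁ y
    ; ⋁ = λ I p f → ⋁ I p (λ i → proj₁ (f i))
                  , ⋁A I p (λ i → proj₁ (proj₂ (f i))) , ⋁-cyc u I p f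
    ; _+_ = λ { (x , a , x≡) (y , b , y≡) →
                x + y , a +A b
                , trans (cong₂′ x≡ y≡) (sym (+-* a b u)) }
    ; 0# = 0# , 0A , sym (0-* u)
    ; _*_ = λ { c (x , a , x≡) → c * x , c · a , trans (cong (c *_) x≡) (sym (·-* c a u)) }
    }
    where
    cong₂′ : ∀ {x x′ y y′} → x ≡ x′ → y ≡ y′ → x + y ≡ x′ + y′
    cong₂′ refl refl = refl

module _ {s : Setting} (𝔸 : AQM s) where
  open AQM 𝔸
  open Quantale quantale renaming (Carrier to A)

  Img : (A → A) → Set
  Img γ = Σ A (λ x → Σ A (λ a → x ≡ γ a))

  A-γ : (A → A) → ModSig s A
  A-γ γ = record
    { Carrier = Img γ
    ; _≈_ = λ x y → proj₁ x ≡ proj₁ y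
    ; ⋁ = λ I p f → let z = ⋁ I p (λ i → proj₁ (f i)) in γ z , z , refl
    ; _+_ = λ x y → let z = proj₁ x + proj₁ y in γ z , z , refl
    ; 0# = γ 0# , 0# , refl
    ; _*_ = λ a x → let z = a · proj₁ x in γ z , z , refl
    }

module _ {s : Setting} {𝔸 : AQM s} (M : Module 𝔸) (u : Quantale.Carrier (Module.quantale M))
         (div : IsDividing M u) where
  open Module M

  to-γ : Cyc M u → Img 𝔸 (γ M u div)
  to-γ (x , a , x≡) = divide M u div x , a , cong (divide M u div) x≡

  from-γ : Img 𝔸 (γ M u div) → Cyc M u
  from-γ (b , _ , _) = b * u , b , refl

{-# OPTIONS --safe #-}
-- Everything follows from the Galois connection  b * u ≤ y ⇔ b ≤ y /* u.
-- It gives (y /* u) * u ≤ y, and since a ≤ γ a also γ a * u = a * u.  So an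
-- element b lies below γ a as soon as b * u = a * u, and each nucleus law
-- reduces to an action law of the module; likewise x /* u = γ b whenever
-- b * u = x, which turns every module operation on A * u into the
-- corresponding operation of A_γ.
module Submission where

open import Defs
open import Data.Product using (Σ; _×_; _,_; proj₁; proj₂)
open import Relation.Binary.PropositionalEquality
  using (_≡_; refl; sym; cong; cong₂; subst; module ≡-Reasoning)
open ≡-Reasoning

module QuantaleProperties {s : Setting} (Q : Quantale s) where
  open Quantale Q

  ≡⇒≤ : ∀ {x y} → x ≡ y → x ≤ y
  ≡⇒≤ refl = ≤-refl

  ⋁-cong : ∀ I p {f h : I → Carrier} → (∀ i → f i ≡ h i) → ⋁ I p f ≡ ⋁ I p h
  ⋁-cong I p {f} {h} f≡h = ≤-antisym
    (⋁-least I p f _ (λ i → ≤-trans (≡⇒≤ (f≡h i)) (⋁-upper I p h i)))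
    (⋁-least I p h _ (λ i → ≤-trans (≡⇒≤ (sym (f≡h i))) (⋁-upper I p f i)))

module Residuation {s : Setting} {𝔸 : AQM s} (M : Module 𝔸)
  (u : Quantale.Carrier (Module.quantale M)) (div : IsDividing M u) where
  open AQM 𝔸 using (_·_)
  module QA = Quantale (AQM.quantale 𝔸)
  module QM = Quantale (Module.quantale M)
  open QuantaleProperties (Module.quantale M)
  open Module M using (_*_; *-mono; ·-*; +-*; 0-*; ⋁-*)
  open QA using () renaming (Carrier to A)
  open QM using (_≤_) renaming (Carrier to Q)

  infix 8 _/u
  _/u : Q → A
  y /u = divide M u div y

  γᵤ : A → A
  γᵤ = γ M u div

  _∈A*u : Q → Set
  x ∈A*u = Σ A (λ a → x ≡ a * u)

  ≤-/u : ∀ {b y} → b * u ≤ y → b QA.≤ y /u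
  ≤-/u {b} h = QA.⋁-upper _ _ proj₁ (b , h)

  /u-*-≤ : ∀ y → y /u * u ≤ y
  /u-*-≤ y = subst (_≤ y) (sym (⋁-* _ _ proj₁ u)) (QM.⋁-least _ _ _ y proj₂)

  γᵤ-expansive : ∀ a → a QA.≤ γᵤ a
  γᵤ-expansive a = ≤-/u QM.≤-refl

  γᵤ-*-≡ : ∀ a → γᵤ a * u ≡ a * u
  γᵤ-*-≡ a = QM.≤-antisym (/u-*-≤ (a * u)) (*-mono (γᵤ-expansive a) QM.≤-refl)

  ≤-γᵤ : ∀ {a b} → b * u ≡ a * u → b QA.≤ γᵤ a
  ≤-γᵤ b*u≡a*u = ≤-/u (≡⇒≤ b*u≡a*u)

  /u-*-cancel : ∀ {x} → x ∈A*u → x /u * u ≡ x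
  /u-*-cancel (a , refl) = γᵤ-*-≡ a

  /u-≡-γᵤ : ∀ {b x} → b * u ≡ x → x /u ≡ γᵤ b
  /u-≡-γᵤ b*u≡x = cong _/u (sym b*u≡x)

  γᵤ-isStructuralNucleus : IsStructuralNucleus (AQM.quantale 𝔸) _·_ γᵤ
  γᵤ-isStructuralNucleus = record
    { mono       = λ {x} {y} x≤y →
                     ≤-/u (subst (_≤ y * u) (sym (γᵤ-*-≡ x)) (*-mono x≤y QM.≤-refl))
    ; expansive  = γᵤ-expansive
    ; idempotent = λ a → cong _/u (γᵤ-*-≡ a)
    ; +-lax      = λ x y → ≤-γᵤ (begin
                     (γᵤ x QA.+ γᵤ y) * u        ≡⟨ +-* (γᵤ x) (γᵤ y) u ⟩
                     γᵤ x * u QM.+ γᵤ y * u      ≡⟨ cong₂ QM._+_ (γᵤ-*-≡ x) (γᵤ-*-≡ y) ⟩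
                     x * u QM.+ y * u            ≡⟨ sym (+-* x y u) ⟩
                     (x QA.+ y) * u              ∎)
    ; *-lax      = λ a x → ≤-γᵤ (begin
                     (a · γᵤ x) * u              ≡⟨ ·-* a (γᵤ x) u ⟩
                     a * (γᵤ x * u)              ≡⟨ cong (a *_) (γᵤ-*-≡ x) ⟩
                     a * (x * u)                 ≡⟨ sym (·-* a x u) ⟩
                     (a · x) * u                 ∎)
    }

  /u-⋁ : ∀ I p (f : I → Q) → (∀ i → f i ∈A*u) →
         QM.⋁ I p f /u ≡ γᵤ (QA.⋁ I p (λ i → f i /u))
  /u-⋁ I p f f∈A*u = /u-≡-γᵤ (begin
    QA.⋁ I p (λ i → f i /u) * u     ≡⟨ ⋁-* I p (λ i → f i /u) u ⟩
    QM.⋁ I p (λ i → f i /u * u)     ≡⟨ ⋁-cong I p (λ i → /u-*-cancel (f∈A*u i)) ⟩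
    QM.⋁ I p f                      ∎)

  /u-+ : ∀ {x y} → x ∈A*u → y ∈A*u → (x QM.+ y) /u ≡ γᵤ (x /u QA.+ y /u)
  /u-+ {x} {y} x∈A*u y∈A*u = /u-≡-γᵤ (begin
    (x /u QA.+ y /u) * u            ≡⟨ +-* (x /u) (y /u) u ⟩
    x /u * u QM.+ y /u * u          ≡⟨ cong₂ QM._+_ (/u-*-cancel x∈A*u) (/u-*-cancel y∈A*u) ⟩
    x QM.+ y                        ∎)

  /u-0 : QM.0# /u ≡ γᵤ QA.0#
  /u-0 = /u-≡-γᵤ (0-* u)

  /u-* : ∀ c {x} → x ∈A*u → (c * x) /u ≡ γᵤ (c · x /u)
  /u-* c {x} x∈A*u = /u-≡-γᵤ (begin
    (c · x /u) * u                  ≡⟨ ·-* c (x /u) u ⟩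
    c * (x /u * u)                  ≡⟨ cong (c *_) (/u-*-cancel x∈A*u) ⟩
    c * x                           ∎)

  γᵤ-*-/u : ∀ a → (γᵤ a * u) /u ≡ γᵤ a
  γᵤ-*-/u a = cong _/u (γᵤ-*-≡ a)

  cyclicSubmodule≅A-γᵤ :
    IsModuleIso (cyclicSubmodule M u) (A-γ 𝔸 γᵤ) (to-γ M u div) (from-γ M u div)
  cyclicSubmodule≅A-γᵤ = record
    { φ-cong = cong _/u
    ; ψ-cong = cong (_* u)
    ; ψ∘φ    = λ (_ , x∈A*u) → /u-*-cancel x∈A*u
    ; φ∘ψ    = λ { (_ , a , refl) → γᵤ-*-/u a }
    ; φ-⋁    = λ I p f → /u-⋁ I p (λ i → proj₁ (f i)) (λ i → proj₂ (f i))
    ; φ-+    = λ (_ , x∈A*u) (_ , y∈A*u) → /u-+ x∈A*u y∈A*u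
    ; φ-0    = /u-0
    ; φ-*    = λ c (_ , x∈A*u) → /u-* c x∈A*u
    }

  cyclicModule≅A-γᵤ : IsCyclic M u →
    Σ (Q → Img 𝔸 γᵤ) (λ φ → Σ (Img 𝔸 γᵤ → Q) (λ ψ →
      IsModuleIso (moduleSig M) (A-γ 𝔸 γᵤ) φ ψ))
  cyclicModule≅A-γᵤ cyclic = (λ x → to-γ M u div (x , cyclic x)) , (λ b → proj₁ b * u) , record
    { φ-cong = cong _/u
    ; ψ-cong = cong (_* u)
    ; ψ∘φ    = λ x → /u-*-cancel (cyclic x)
    ; φ∘ψ    = λ { (_ , a , refl) → γᵤ-*-/u a }
    ; φ-⋁    = λ I p f → /u-⋁ I p f (λ i → cyclic (f i))
    ; φ-+    = λ x y → /u-+ (cyclic x) (cyclic y)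
    ; φ-0    = /u-0
    ; φ-*    = λ c x → /u-* c (cyclic x)
    }

lemma6p6 : {s : Setting} (𝔸 : AQM s) → DistributivelyGenerated 𝔸 →
           (M : Module 𝔸) (u : Quantale.Carrier (Module.quantale M))
           (div : IsDividing M u) →
           -- (i) γ_u is a structural nucleus on A (A acting on itself by ·)
           IsStructuralNucleus (AQM.quantale 𝔸) (AQM._·_ 𝔸) (γ M u div)
           -- (ii) A * u ≅ A_{γ_u} via x ↦ x /* u and a ↦ a * u
           × IsModuleIso (cyclicSubmodule M u) (A-γ 𝔸 (γ M u div))
               (to-γ M u div) (from-γ M u div)
           -- in particular: a u-cyclic Q is isomorphic to A_{γ_u}
           × (IsCyclic M u →
                Σ (Quantale.Carrier (Module.quantale M) → Img 𝔸 (γ M u div)) (λ φ →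
                Σ (Img 𝔸 (γ M u div) → Quantale.Carrier (Module.quantale M)) (λ ψ →
                IsModuleIso (moduleSig M) (A-γ 𝔸 (γ M u div)) φ ψ)))
lemma6p6 𝔸 _ M u div =
  γᵤ-isStructuralNucleus , cyclicSubmodule≅A-γᵤ , cyclicModule≅A-γᵤ
  where open Residuation M u div
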